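{- Let $G=(V,E)$ be a finite graph with boundary $B\subseteq V$, $|B|\ge 2$, and let $\delta_B=\min_{x\in B}\deg(x)$ be the minimum degree of boundary vertices. Then $$\sigma_2(G,B)\le \frac{|B|}{|B|-1}\,\delta_B.$$
   Context: Steklov eigenvalues: for a finite graph $G=(V,E)$ and boundary $B\subseteq V$ with $|B|\ge2$, let $R(f)=\frac{\sum_{(x,y)\in E}(f(x)-f(y))^2}{\sum_{x\in B}f(x)^2}$ for $f\in\mathbb{R}^V$ ($+\infty$ if $f|_B\equiv0$), and $\sigma_k=\min_{\dim W=k}\max_{f\in W\setminus\{0\}}R(f)$ over subspaces $W\subseteq\mathbb{R}^V$. Equivalently $\sigma_2=\min\{R(f): f|_B\not\equiv0,\ \sum_{x\in B}f(x)=0\}$. Here $\deg(x)$ is the degree of $x$ in $G$. -}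

module Defs where

open import Data.Bool using (Bool; true; false; if_then_else_; _∧_)
open import Data.Nat as ℕ using (ℕ; zero; suc; _⊓_; _≤_; s≤s)
open import Data.Fin using (Fin; _<?_)
open import Data.Fin.Subset using (Subset; ∣_∣)
open import Data.List using (List; []; _∷_; foldr; map; filterᵇ)
open import Data.List using () renaming (allFin to allFinL)
open import Data.Vec using (lookup)
open import Data.Integer using (+_)
open import Data.Rational as ℚ using (ℚ; 0ℚ; _/_)
open import Relation.Nullary.Decidable using (⌊_⌋)
open import Relation.Binary.PropositionalEquality using (_≡_)

record Graph (n : ℕ) : Set where
  field
    adj    : Fin n → Fin n → Bool
    sym    : ∀ x y → adj x y ≡ adj y x
    irrefl : ∀ x → adj x x ≡ false
open Graph public

vertices : (n : ℕ) → List (Fin n)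
vertices n = allFinL n

sumℕ : List ℕ → ℕ
sumℕ = foldr ℕ._+_ 0

sumℚ : List ℚ → ℚ
sumℚ = foldr ℚ._+_ 0ℚ

deg : ∀ {n} → Graph n → Fin n → ℕ
deg {n} G x = sumℕ (map (λ y → if adj G x y then 1 else 0) (vertices n))

boundaryList : ∀ {n} → Subset n → List (Fin n)
boundaryList {n} B = filterᵇ (λ x → lookup B x) (vertices n)

-- δ_B = min_{x ∈ B} deg(x)   (value 0 if B is empty; irrelevant since |B| ≥ 2)
minList : List ℕ → ℕ
minList []       = 0
minList (d ∷ ds) = foldr _⊓_ d ds

δB : ∀ {n} → Graph n → Subset n → ℕ
δB G B = minList (map (deg G) (boundaryList B))

sq : ℚ → ℚ
sq q = q ℚ.* q

-- Dirichlet energy  Σ_{(x,y) ∈ E} (f x - f y)^2 ; each edge counted once (x < y)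
energy : ∀ {n} → Graph n → (Fin n → ℚ) → ℚ
energy {n} G f =
  sumℚ (map (λ x → sumℚ (map (λ y →
      if ⌊ x <? y ⌋ ∧ adj G x y then sq (f x ℚ.- f y) else 0ℚ)
    (vertices n))) (vertices n))

boundarySum : ∀ {n} → Subset n → (Fin n → ℚ) → ℚ
boundarySum B f = sumℚ (map f (boundaryList B))

boundaryNorm : ∀ {n} → Subset n → (Fin n → ℚ) → ℚ
boundaryNorm B f = sumℚ (map (λ x → sq (f x)) (boundaryList B))

-- R(f) ≤ c, for f with f|_B ≢ 0 (so the denominator is positive), written
-- without division:  Σ_E (f x - f y)^2 ≤ c · Σ_B f^2.
RayleighLe : ∀ {n} → Graph n → Subset n → (Fin n → ℚ) → ℚ → Set
RayleighLe G B f c = energy G f ℚ.≤ c ℚ.* boundaryNorm B f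

NonzeroOnBoundary : ∀ {n} → Subset n → (Fin n → ℚ) → Set
NonzeroOnBoundary {n} B f = Data.Product.Σ (Fin n) (λ x → lookup B x ≡ true Data.Product.× (f x ≡ 0ℚ → Data.Empty.⊥))
  where import Data.Product; import Data.Empty

-- σ₂(G,B) ≤ c, via  σ₂ = min { R(f) : f|_B ≢ 0, Σ_{x∈B} f(x) = 0 }
-- (the minimum is attained, so σ₂ ≤ c iff some admissible f has R(f) ≤ c).
Sigma2Le : ∀ {n} → Graph n → Subset n → ℚ → Set
Sigma2Le {n} G B c =
  Data.Product.Σ (Fin n → ℚ) λ f →
    boundarySum B f ≡ 0ℚ Data.Product.×
    NonzeroOnBoundary B f Data.Product.×
    RayleighLe G B f c
  where import Data.Product

steklovBound : (b δ : ℕ) → 2 ≤ b → ℚ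
steklovBound (suc (suc k)) δ (ℕ.s≤s (ℕ.s≤s _)) = + (suc (suc k) ℕ.* δ) / suc k

-- Test σ₂ against the spike f = |B|·𝟙ᵥ − 1 at a boundary vertex v of minimum degree.
-- It sums to zero over B; only the deg(v) edges at v see a jump, each of size |B|, so the
-- energy is |B|²·deg(v); and Σ_B f² = (|B| − 1)² + (|B| − 1) = |B|(|B| − 1).  Hence
-- R(f) = |B|·δ_B/(|B| − 1) exactly.
module Submission where

open import Defs hiding (sym)
open import Data.Nat using (ℕ; _≤_)
open import Data.Fin.Subset using (Subset; ∣_∣)

import Algebra.Properties.Semiring.Sum as Sum
open import Data.Bool using (Bool; true; false; if_then_else_; _∧_)
open import Data.Empty using (⊥-elim)
open import Data.Fin as Fin using (Fin; zero; suc; _<?_)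
import Data.Fin.Properties as Finₚ
open import Data.Integer as ℤ using (+_)
import Data.Integer.Properties as ℤₚ
open import Data.Integer.Tactic.RingSolver using (solve-∀)
open import Data.List using ([]; _∷_; map; filterᵇ; foldr; tabulate; length)
import Data.List.Properties as Listₚ
open import Data.List.Relation.Unary.All using (All; []; _∷_)
open import Data.Nat as ℕ using (_+_; _*_)
import Data.Nat.Properties as ℕₚ
open import Data.Product using (Σ; _×_; _,_)
open import Data.Rational as ℚ using (ℚ; 0ℚ; 1ℚ; _/_)
import Data.Rational.Properties as ℚₚ
open import Data.Rational.Solver using (module +-*-Solver)
open import Data.Rational.Unnormalised as ℚᵘ using (mkℚᵘ; *≡*)
import Data.Rational.Unnormalised.Properties as ℚᵘₚ
open import Data.Sum using (inj₁; inj₂)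
open import Data.Vec as Vec using (lookup)
import Data.Vec.Functional as Vector
open import Function using (id; _∘_)
open import Relation.Binary.PropositionalEquality
  using (_≡_; _≢_; refl; sym; trans; cong; cong₂; subst; module ≡-Reasoning)
open import Relation.Nullary using (does; yes; no)
open import Relation.Nullary.Decidable using (⌊_⌋; dec-true)

open Sum ℕₚ.+-*-semiring
  using (sum-syntax; ∑-distrib-+; *-distribˡ-sum; *-distribʳ-sum; sum-cong-≗; sum-replicate-zero)

private variable A B : Set

toℚᵘ-/ : ∀ m k → ℚ.toℚᵘ (+ m / ℕ.suc k) ℚᵘ.≃ mkℚᵘ (+ m) k
toℚᵘ-/ m k = ℚₚ.toℚᵘ-fromℚᵘ (mkℚᵘ (+ m) k)

-- All sums are evaluated in ℕ and carried to ℚ along fromℕ.  It is opaque so that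
-- conversion checking never unfolds the gcd normalisation inside + n / 1.
opaque
  fromℕ : ℕ → ℚ
  fromℕ n = + n / 1

  fromℕ-0 : fromℕ 0 ≡ 0ℚ
  fromℕ-0 = refl

  fromℕ-1 : fromℕ 1 ≡ 1ℚ
  fromℕ-1 = refl

  fromℕ-homo-+ : ∀ m n → fromℕ (m + n) ≡ fromℕ m ℚ.+ fromℕ n
  fromℕ-homo-+ m n = ℚₚ.toℚᵘ-injective (begin
    ℚ.toℚᵘ (fromℕ (m + n))                   ≈⟨ toℚᵘ-/ (m + n) 0 ⟩
    mkℚᵘ (+ (m + n)) 0                       ≈⟨ *≡* (trans (cong (ℤ._* + 1) (ℤₚ.pos-+ m n)) (*1-distrib (+ m) (+ n))) ⟩
    mkℚᵘ (+ m) 0 ℚᵘ.+ mkℚᵘ (+ n) 0           ≈⟨ ℚᵘₚ.+-cong (toℚᵘ-/ m 0) (toℚᵘ-/ n 0) ⟨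
    ℚ.toℚᵘ (fromℕ m) ℚᵘ.+ ℚ.toℚᵘ (fromℕ n)   ≈⟨ ℚₚ.toℚᵘ-homo-+ (fromℕ m) (fromℕ n) ⟨
    ℚ.toℚᵘ (fromℕ m ℚ.+ fromℕ n)             ∎)
    where
    open ℚᵘₚ.≃-Reasoning
    *1-distrib : ∀ i j → (i ℤ.+ j) ℤ.* + 1 ≡ (i ℤ.* + 1 ℤ.+ j ℤ.* + 1) ℤ.* + 1
    *1-distrib = solve-∀

  fromℕ-homo-* : ∀ m n → fromℕ (m * n) ≡ fromℕ m ℚ.* fromℕ n
  fromℕ-homo-* m n = ℚₚ.toℚᵘ-injective (begin
    ℚ.toℚᵘ (fromℕ (m * n))                   ≈⟨ toℚᵘ-/ (m * n) 0 ⟩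
    mkℚᵘ (+ (m * n)) 0                       ≈⟨ *≡* (cong (ℤ._* + 1) (ℤₚ.pos-* m n)) ⟩
    mkℚᵘ (+ m) 0 ℚᵘ.* mkℚᵘ (+ n) 0           ≈⟨ ℚᵘₚ.*-cong (toℚᵘ-/ m 0) (toℚᵘ-/ n 0) ⟨
    ℚ.toℚᵘ (fromℕ m) ℚᵘ.* ℚ.toℚᵘ (fromℕ n)   ≈⟨ ℚₚ.toℚᵘ-homo-* (fromℕ m) (fromℕ n) ⟨
    ℚ.toℚᵘ (fromℕ m ℚ.* fromℕ n)             ∎)
    where open ℚᵘₚ.≃-Reasoning

  fromℕ-injective : ∀ {m n} → fromℕ m ≡ fromℕ n → m ≡ n
  fromℕ-injective {m} {n} eq = ℤₚ.+-injective (begin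
    + m           ≡⟨ ℤₚ.*-identityʳ (+ m) ⟨
    + m ℤ.* + 1   ≡⟨ ℚᵘₚ.drop-*≡* m≃n ⟩
    + n ℤ.* + 1   ≡⟨ ℤₚ.*-identityʳ (+ n) ⟩
    + n           ∎)
    where
    open ≡-Reasoning
    m≃n : mkℚᵘ (+ m) 0 ℚᵘ.≃ mkℚᵘ (+ n) 0
    m≃n = ℚᵘₚ.≃-trans (ℚᵘₚ.≃-sym (toℚᵘ-/ m 0)) (ℚᵘₚ.≃-trans (ℚₚ.toℚᵘ-cong eq) (toℚᵘ-/ n 0))

  m/n*n≡m : ∀ m k → (+ m / ℕ.suc k) ℚ.* fromℕ (ℕ.suc k) ≡ fromℕ m
  m/n*n≡m m k = ℚₚ.toℚᵘ-injective (begin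
    ℚ.toℚᵘ ((+ m / ℕ.suc k) ℚ.* fromℕ (ℕ.suc k))           ≈⟨ ℚₚ.toℚᵘ-homo-* (+ m / ℕ.suc k) (fromℕ (ℕ.suc k)) ⟩
    ℚ.toℚᵘ (+ m / ℕ.suc k) ℚᵘ.* ℚ.toℚᵘ (fromℕ (ℕ.suc k))  ≈⟨ ℚᵘₚ.*-cong (toℚᵘ-/ m k) (toℚᵘ-/ (ℕ.suc k) 0) ⟩
    mkℚᵘ (+ m) k ℚᵘ.* mkℚᵘ (+ ℕ.suc k) 0                   ≈⟨ *≡* (ℤₚ.*-assoc (+ m) (+ ℕ.suc k) (+ 1)) ⟩
    mkℚᵘ (+ m) 0                                            ≈⟨ toℚᵘ-/ m 0 ⟨
    ℚ.toℚᵘ (fromℕ m)                                        ∎)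
    where open ℚᵘₚ.≃-Reasoning

fromℕ-suc-1 : ∀ m → fromℕ (ℕ.suc m) ℚ.- 1ℚ ≡ fromℕ m
fromℕ-suc-1 m = begin
  fromℕ (1 + m) ℚ.- 1ℚ          ≡⟨ cong (ℚ._- 1ℚ) (fromℕ-homo-+ 1 m) ⟩
  fromℕ 1 ℚ.+ fromℕ m ℚ.- 1ℚ    ≡⟨ cong (λ z → z ℚ.+ fromℕ m ℚ.- 1ℚ) fromℕ-1 ⟩
  1ℚ ℚ.+ fromℕ m ℚ.- 1ℚ         ≡⟨ 1+M-1≡M (fromℕ m) ⟩
  fromℕ m                       ∎
  where
  open ≡-Reasoning
  open +-*-Solver
  1+M-1≡M : ∀ M → 1ℚ ℚ.+ M ℚ.- 1ℚ ≡ M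
  1+M-1≡M = solve 1 (λ M → con 1ℚ :+ M :- con 1ℚ := M) refl

[_] : Bool → ℕ
[ b ] = if b then 1 else 0

if-1-0≡fromℕ : ∀ b → (if b then 1ℚ else 0ℚ) ≡ fromℕ [ b ]
if-1-0≡fromℕ true  = sym fromℕ-1
if-1-0≡fromℕ false = sym fromℕ-0

𝟙 : ∀ {n} → Fin n → Fin n → ℕ
𝟙 v x = [ does (x Fin.≟ v) ]

𝟙-self : ∀ {n} (v : Fin n) → 𝟙 v v ≡ 1
𝟙-self v = cong [_] (dec-true (v Fin.≟ v) refl)

foldr-tabulate : ∀ {n} (f : A → B → B) z (h : Fin n → A) →
                 foldr f z (tabulate h) ≡ Vector.foldr f z h
foldr-tabulate {n = ℕ.zero}  f z h = refl
foldr-tabulate {n = ℕ.suc n} f z h = cong (f (h zero)) (foldr-tabulate f z (h ∘ suc))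

sumℕ-vertices : ∀ {n} (h : Fin n → ℕ) → sumℕ (map h (vertices n)) ≡ ∑[ x < n ] h x
sumℕ-vertices {n} h = trans (cong sumℕ (Listₚ.map-tabulate id h)) (foldr-tabulate _+_ 0 h)

∑-sift : ∀ {n} (h : Fin n → ℕ) v → ∑[ x < n ] (h x * 𝟙 v x) ≡ h v
∑-sift {ℕ.suc n} h zero = begin
  h zero * 1 + ∑[ x < n ] (h (suc x) * 0)  ≡⟨ cong₂ _+_ (ℕₚ.*-identityʳ (h zero)) ∑0≡0 ⟩
  h zero + 0                               ≡⟨ ℕₚ.+-identityʳ (h zero) ⟩
  h zero                                   ∎
  where
  open ≡-Reasoning
  ∑0≡0 : ∑[ x < n ] (h (suc x) * 0) ≡ 0
  ∑0≡0 = trans (sum-cong-≗ (ℕₚ.*-zeroʳ ∘ h ∘ suc)) (sum-replicate-zero n)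
∑-sift {ℕ.suc n} h (suc v) =
  trans (cong (_+ ∑[ x < n ] (h (suc x) * 𝟙 v x)) (ℕₚ.*-zeroʳ (h zero))) (∑-sift (h ∘ suc) v)

∑-lookup≡∣∣ : ∀ {n} (B : Subset n) → ∑[ x < n ] [ lookup B x ] ≡ ∣ B ∣
∑-lookup≡∣∣ Vec.[]          = refl
∑-lookup≡∣∣ (true  Vec.∷ B) = cong ℕ.suc (∑-lookup≡∣∣ B)
∑-lookup≡∣∣ (false Vec.∷ B) = ∑-lookup≡∣∣ B

sumℚ-map-fromℕ : ∀ (g : A → ℕ) xs → sumℚ (map (fromℕ ∘ g) xs) ≡ fromℕ (sumℕ (map g xs))
sumℚ-map-fromℕ g []       = sym fromℕ-0
sumℚ-map-fromℕ g (x ∷ xs) =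
  trans (cong (fromℕ (g x) ℚ.+_) (sumℚ-map-fromℕ g xs)) (sym (fromℕ-homo-+ (g x) _))

sumℚ-map-sub : ∀ (g h : A → ℚ) xs →
             sumℚ (map (λ x → g x ℚ.- h x) xs) ≡ sumℚ (map g xs) ℚ.- sumℚ (map h xs)
sumℚ-map-sub g h []       = refl
sumℚ-map-sub g h (x ∷ xs) =
  trans (cong (g x ℚ.- h x ℚ.+_) (sumℚ-map-sub g h xs)) (interchange (g x) (h x) _ _)
  where
  open +-*-Solver
  interchange : ∀ p q r s → p ℚ.- q ℚ.+ (r ℚ.- s) ≡ p ℚ.+ r ℚ.- (q ℚ.+ s)
  interchange = solve 4 (λ p q r s → p :- q :+ (r :- s) := p :+ r :- (q :+ s)) refl

sumℚ-map-filterᵇ : ∀ (p : A → Bool) (h : A → ℚ) xs →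
  sumℚ (map h (filterᵇ p xs)) ≡ sumℚ (map (λ x → if p x then h x else 0ℚ) xs)
sumℚ-map-filterᵇ p h [] = refl
sumℚ-map-filterᵇ p h (x ∷ xs) with p x
... | true  = cong (h x ℚ.+_) (sumℚ-map-filterᵇ p h xs)
... | false = trans (sumℚ-map-filterᵇ p h xs) (sym (ℚₚ.+-identityˡ _))

sumℚ-vertices-fromℕ : ∀ {n} {h : Fin n → ℚ} (g : Fin n → ℕ) → (∀ x → h x ≡ fromℕ (g x)) →
                      sumℚ (map h (vertices n)) ≡ fromℕ (∑[ x < n ] g x)
sumℚ-vertices-fromℕ {n} {h} g h≗g = begin
  sumℚ (map h (vertices n))            ≡⟨ cong sumℚ (Listₚ.map-cong h≗g (vertices n)) ⟩
  sumℚ (map (fromℕ ∘ g) (vertices n))  ≡⟨ sumℚ-map-fromℕ g (vertices n) ⟩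
  fromℕ (sumℕ (map g (vertices n)))    ≡⟨ cong fromℕ (sumℕ-vertices g) ⟩
  fromℕ (∑[ x < n ] g x)               ∎
  where open ≡-Reasoning

sumℚ-boundary-fromℕ : ∀ {n} (B : Subset n) {h : Fin n → ℚ} (g : Fin n → ℕ) →
                      (∀ x → (if lookup B x then h x else 0ℚ) ≡ fromℕ (g x)) →
                      sumℚ (map h (boundaryList B)) ≡ fromℕ (∑[ x < n ] g x)
sumℚ-boundary-fromℕ {n} B {h} g eq =
  trans (sumℚ-map-filterᵇ (lookup B) h (vertices n)) (sumℚ-vertices-fromℕ g eq)

deg≡∑adj : ∀ {n} (G : Graph n) x → deg G x ≡ ∑[ y < n ] [ adj G x y ]
deg≡∑adj G x = sumℕ-vertices (λ y → [ adj G x y ])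

edge : ∀ {n} → Graph n → Fin n → Fin n → ℕ
edge G x y = [ ⌊ x <? y ⌋ ∧ adj G x y ]

edge+edge≡adj : ∀ {n} (G : Graph n) x y → edge G x y + edge G y x ≡ [ adj G x y ]
edge+edge≡adj G x y with x <? y | y <? x
... | yes x<y | yes y<x = ⊥-elim (Finₚ.<-asym x<y y<x)
... | yes _   | no _    = ℕₚ.+-identityʳ _
... | no _    | yes _   = cong [_] (Graph.sym G y x)
... | no x≮y  | no y≮x  with Finₚ.≤-antisym (ℕₚ.≮⇒≥ y≮x) (ℕₚ.≮⇒≥ x≮y)
...   | refl = cong [_] (sym (irrefl G x))

incidence : ∀ {n} → Graph n → Fin n → Fin n → Fin n → ℕ
incidence G v x y = edge G x y * (𝟙 v x + 𝟙 v y)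

∑-incidence≡deg : ∀ {n} (G : Graph n) v → ∑[ x < n ] ∑[ y < n ] incidence G v x y ≡ deg G v
∑-incidence≡deg {n} G v = begin
  ∑[ x < n ] ∑[ y < n ] (edge G x y * (𝟙 v x + 𝟙 v y))
    ≡⟨ sum-cong-≗ (λ x → trans (sum-cong-≗ (λ y → ℕₚ.*-distribˡ-+ (edge G x y) (𝟙 v x) (𝟙 v y)))
                               (∑-distrib-+ (λ y → edge G x y * 𝟙 v x) (λ y → edge G x y * 𝟙 v y))) ⟩
  ∑[ x < n ] (∑[ y < n ] (edge G x y * 𝟙 v x) + ∑[ y < n ] (edge G x y * 𝟙 v y))
    ≡⟨ ∑-distrib-+ (λ x → ∑[ y < n ] (edge G x y * 𝟙 v x)) (λ x → ∑[ y < n ] (edge G x y * 𝟙 v y)) ⟩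
  ∑[ x < n ] ∑[ y < n ] (edge G x y * 𝟙 v x) + ∑[ x < n ] ∑[ y < n ] (edge G x y * 𝟙 v y)
    ≡⟨ cong₂ _+_ (trans (sum-cong-≗ (λ x → sym (*-distribʳ-sum (𝟙 v x) (edge G x))))
                        (∑-sift (λ x → ∑[ y < n ] edge G x y) v))
                 (sum-cong-≗ (λ x → ∑-sift (edge G x) v)) ⟩
  ∑[ y < n ] edge G v y + ∑[ x < n ] edge G x v
    ≡⟨ ∑-distrib-+ (edge G v) (λ y → edge G y v) ⟨
  ∑[ y < n ] (edge G v y + edge G y v)
    ≡⟨ sum-cong-≗ (edge+edge≡adj G v) ⟩
  ∑[ y < n ] [ adj G v y ]
    ≡⟨ deg≡∑adj G v ⟨
  deg G v
    ∎
  where open ≡-Reasoning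

minList-attained : ∀ {P : A → Set} (g : A → ℕ) {x xs} → All P (x ∷ xs) →
                   Σ A λ y → P y × g y ≡ minList (map g (x ∷ xs))
minList-attained g {x} {[]}     (px ∷ [])       = x , px , refl
minList-attained g {x} {y ∷ ys} (px ∷ py ∷ pys)
  with minList-attained g (px ∷ pys) | ℕₚ.⊓-sel (g y) (foldr ℕ._⊓_ (g x) (map g ys))
... | _ , _   , _    | inj₁ g[y]≡min = y , py , sym g[y]≡min
... | z , pz , g[z]≡ | inj₂ min≡     = z , pz , trans g[z]≡ (sym min≡)

length-filterᵇ : ∀ (p : A → Bool) xs → length (filterᵇ p xs) ≡ sumℕ (map (λ x → [ p x ]) xs)
length-filterᵇ p []       = refl
length-filterᵇ p (x ∷ xs) with p x
... | true  = cong ℕ.suc (length-filterᵇ p xs)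
... | false = length-filterᵇ p xs

all-filterᵇ : ∀ (p : A → Bool) xs → All (λ x → p x ≡ true) (filterᵇ p xs)
all-filterᵇ p []       = []
all-filterᵇ p (x ∷ xs) with p x in px
... | true  = px ∷ all-filterᵇ p xs
... | false = all-filterᵇ p xs

length-boundaryList : ∀ {n} (B : Subset n) → length (boundaryList B) ≡ ∣ B ∣
length-boundaryList {n} B = begin
  length (boundaryList B)                         ≡⟨ length-filterᵇ (lookup B) (vertices n) ⟩
  sumℕ (map (λ x → [ lookup B x ]) (vertices n))  ≡⟨ sumℕ-vertices (λ x → [ lookup B x ]) ⟩
  ∑[ x < n ] [ lookup B x ]                       ≡⟨ ∑-lookup≡∣∣ B ⟩
  ∣ B ∣                                           ∎
  where open ≡-Reasoning

δB-attained : ∀ {n} (G : Graph n) (B : Subset n) → 0 ℕ.< ∣ B ∣ →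
              Σ (Fin n) λ v → lookup B v ≡ true × deg G v ≡ δB G B
δB-attained {n} G B 0<∣B∣
  with boundaryList B | length-boundaryList B | all-filterᵇ (lookup B) (vertices n)
... | []     | 0≡∣B∣ | _      = ⊥-elim (ℕₚ.<⇒≢ 0<∣B∣ 0≡∣B∣)
... | _ ∷ _  | _     | ∈B-all = minList-attained (deg G) ∈B-all

spike : ∀ {n} → Fin n → ℕ → ℚ → Fin n → ℚ
spike v a c x = fromℕ (a * 𝟙 v x) ℚ.- c

sq-𝟙-diff : ∀ {n} (v : Fin n) {x y} → x ≢ y →
            sq (fromℕ (𝟙 v x) ℚ.- fromℕ (𝟙 v y)) ≡ fromℕ (𝟙 v x + 𝟙 v y)
sq-𝟙-diff v {x} {y} x≢y with x Fin.≟ v | y Fin.≟ v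
... | yes refl | yes refl = ⊥-elim (x≢y refl)
... | yes _    | no _     rewrite fromℕ-0 | fromℕ-1 = refl
... | no _     | yes _    rewrite fromℕ-0 | fromℕ-1 = refl
... | no _     | no _     rewrite fromℕ-0 = refl

sq-spike-diff : ∀ {n} (v : Fin n) a c {x y} → x ≢ y →
  sq (spike v a c x ℚ.- spike v a c y) ≡ fromℕ (a * a * (𝟙 v x + 𝟙 v y))
sq-spike-diff v a c {x} {y} x≢y = begin
  sq (spike v a c x ℚ.- spike v a c y)
    ≡⟨ cong₂ (λ s t → sq (s ℚ.- c ℚ.- (t ℚ.- c))) (fromℕ-homo-* a (𝟙 v x)) (fromℕ-homo-* a (𝟙 v y)) ⟩
  sq (â ℚ.* x̂ ℚ.- c ℚ.- (â ℚ.* ŷ ℚ.- c))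
    ≡⟨ shift-scale â x̂ ŷ c ⟩
  â ℚ.* â ℚ.* sq (x̂ ℚ.- ŷ)
    ≡⟨ cong (â ℚ.* â ℚ.*_) (sq-𝟙-diff v x≢y) ⟩
  â ℚ.* â ℚ.* fromℕ (𝟙 v x + 𝟙 v y)
    ≡⟨ trans (fromℕ-homo-* (a * a) (𝟙 v x + 𝟙 v y)) (cong (ℚ._* fromℕ (𝟙 v x + 𝟙 v y)) (fromℕ-homo-* a a)) ⟨
  fromℕ (a * a * (𝟙 v x + 𝟙 v y))
    ∎
  where
  open ≡-Reasoning
  open +-*-Solver
  â x̂ ŷ : ℚ
  â = fromℕ a
  x̂ = fromℕ (𝟙 v x)
  ŷ = fromℕ (𝟙 v y)
  shift-scale : ∀ A X Y C → sq (A ℚ.* X ℚ.- C ℚ.- (A ℚ.* Y ℚ.- C)) ≡ A ℚ.* A ℚ.* sq (X ℚ.- Y)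
  shift-scale = solve 4 (λ A X Y C → (A :* X :- C :- (A :* Y :- C)) :* (A :* X :- C :- (A :* Y :- C))
                                     := A :* A :* ((X :- Y) :* (X :- Y))) refl

energy-spike : ∀ {n} (G : Graph n) v a c → energy G (spike v a c) ≡ fromℕ (a * a * deg G v)
energy-spike {n} G v a c = begin
  energy G (spike v a c)
    ≡⟨ sumℚ-vertices-fromℕ _ (λ x → sumℚ-vertices-fromℕ _ (summand x)) ⟩
  fromℕ (∑[ x < n ] ∑[ y < n ] (a * a * incidence G v x y))
    ≡⟨ cong fromℕ (trans (sum-cong-≗ (λ x → sym (*-distribˡ-sum (a * a) (λ y → incidence G v x y))))
                         (sym (*-distribˡ-sum (a * a) (λ x → ∑[ y < n ] incidence G v x y)))) ⟩
  fromℕ (a * a * ∑[ x < n ] ∑[ y < n ] incidence G v x y)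
    ≡⟨ cong (λ d → fromℕ (a * a * d)) (∑-incidence≡deg G v) ⟩
  fromℕ (a * a * deg G v)
    ∎
  where
  open ≡-Reasoning
  no-edge : 0ℚ ≡ fromℕ (a * a * 0)
  no-edge = sym (trans (cong fromℕ (ℕₚ.*-zeroʳ (a * a))) fromℕ-0)
  summand : ∀ x y → (if ⌊ x <? y ⌋ ∧ adj G x y then sq (spike v a c x ℚ.- spike v a c y) else 0ℚ)
                    ≡ fromℕ (a * a * incidence G v x y)
  summand x y with x <? y
  ... | no _ = no-edge
  ... | yes x<y with adj G x y
  ...   | false = no-edge
  ...   | true  = trans (sq-spike-diff v a c (Finₚ.<⇒≢ x<y))
                        (cong (λ m → fromℕ (a * a * m)) (sym (ℕₚ.+-identityʳ _)))

module _ {n} (B : Subset n) {v : Fin n} (v∈B : lookup B v ≡ true) where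

  𝟙-∉ : ∀ {x} → lookup B x ≡ false → 𝟙 v x ≡ 0
  𝟙-∉ {x} x∉B with x Fin.≟ v
  ... | no _ = refl
  ... | yes refl with trans (sym v∈B) x∉B
  ...   | ()

  boundarySum-spike : ∀ a → boundarySum B (spike v a 1ℚ) ≡ fromℕ a ℚ.- fromℕ ∣ B ∣
  boundarySum-spike a = begin
    boundarySum B (spike v a 1ℚ)
      ≡⟨ sumℚ-map-sub (λ x → fromℕ (a * 𝟙 v x)) (λ _ → 1ℚ) (boundaryList B) ⟩
    sumℚ (map (λ x → fromℕ (a * 𝟙 v x)) (boundaryList B)) ℚ.- sumℚ (map (λ _ → 1ℚ) (boundaryList B))
      ≡⟨ cong₂ ℚ._-_ (sumℚ-boundary-fromℕ B (λ x → a * 𝟙 v x) summand)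
                     (sumℚ-boundary-fromℕ B (λ x → [ lookup B x ]) (if-1-0≡fromℕ ∘ lookup B)) ⟩
    fromℕ (∑[ x < n ] (a * 𝟙 v x)) ℚ.- fromℕ (∑[ x < n ] [ lookup B x ])
      ≡⟨ cong₂ (λ s t → fromℕ s ℚ.- fromℕ t) (∑-sift (λ _ → a) v) (∑-lookup≡∣∣ B) ⟩
    fromℕ a ℚ.- fromℕ ∣ B ∣
      ∎
    where
    open ≡-Reasoning
    summand : ∀ x → (if lookup B x then fromℕ (a * 𝟙 v x) else 0ℚ) ≡ fromℕ (a * 𝟙 v x)
    summand x with lookup B x in x∈?B
    ... | true  = refl
    ... | false = sym (trans (cong (λ m → fromℕ (a * m)) (𝟙-∉ x∈?B))
                             (trans (cong fromℕ (ℕₚ.*-zeroʳ a)) fromℕ-0))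

  -- The height is written 2 + k so that (2 + k − 1)² = 1 + k (2 + k) needs no truncated subtraction.
  boundaryNorm-spike : ∀ k → boundaryNorm B (spike v (2 + k) 1ℚ) ≡ fromℕ (∣ B ∣ + k * (2 + k))
  boundaryNorm-spike k = begin
    boundaryNorm B (spike v b 1ℚ)
      ≡⟨ sumℚ-boundary-fromℕ B (λ x → [ lookup B x ] + k * b * 𝟙 v x) summand ⟩
    fromℕ (∑[ x < n ] ([ lookup B x ] + k * b * 𝟙 v x))
      ≡⟨ cong fromℕ (∑-distrib-+ (λ x → [ lookup B x ]) (λ x → k * b * 𝟙 v x)) ⟩
    fromℕ (∑[ x < n ] [ lookup B x ] + ∑[ x < n ] (k * b * 𝟙 v x))
      ≡⟨ cong₂ (λ s t → fromℕ (s + t)) (∑-lookup≡∣∣ B) (∑-sift (λ _ → k * b) v) ⟩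
    fromℕ (∣ B ∣ + k * b)
      ∎
    where
    open ≡-Reasoning
    b : ℕ
    b = 2 + k
    summand : ∀ x → (if lookup B x then sq (spike v b 1ℚ x) else 0ℚ)
                    ≡ fromℕ ([ lookup B x ] + k * b * 𝟙 v x)
    summand x with lookup B x in x∈?B
    ... | false = sym (trans (cong (λ m → fromℕ (k * b * m)) (𝟙-∉ x∈?B))
                             (trans (cong fromℕ (ℕₚ.*-zeroʳ (k * b))) fromℕ-0))
    ... | true with x Fin.≟ v
    ...   | no _ = begin
      sq (fromℕ (b * 0) ℚ.- 1ℚ)      ≡⟨ cong (λ m → sq (fromℕ m ℚ.- 1ℚ)) (ℕₚ.*-zeroʳ b) ⟩
      sq (fromℕ 0 ℚ.- 1ℚ)            ≡⟨ cong (λ z → sq (z ℚ.- 1ℚ)) fromℕ-0 ⟩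
      1ℚ                             ≡⟨ fromℕ-1 ⟨
      fromℕ 1                        ≡⟨ cong (λ m → fromℕ (1 + m)) (ℕₚ.*-zeroʳ (k * b)) ⟨
      fromℕ (1 + k * b * 0)          ∎
    ...   | yes _ = begin
      sq (fromℕ (b * 1) ℚ.- 1ℚ)      ≡⟨ cong (λ m → sq (fromℕ m ℚ.- 1ℚ)) (ℕₚ.*-identityʳ b) ⟩
      sq (fromℕ b ℚ.- 1ℚ)            ≡⟨ cong sq (fromℕ-suc-1 (ℕ.suc k)) ⟩
      sq (fromℕ (ℕ.suc k))           ≡⟨ fromℕ-homo-* (ℕ.suc k) (ℕ.suc k) ⟨
      fromℕ (ℕ.suc k * ℕ.suc k)      ≡⟨ cong (fromℕ ∘ ℕ.suc) (ℕₚ.*-suc k (ℕ.suc k)) ⟨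
      fromℕ (1 + k * b)              ≡⟨ cong (λ m → fromℕ (1 + m)) (ℕₚ.*-identityʳ (k * b)) ⟨
      fromℕ (1 + k * b * 1)          ∎

σ₂≤-boundary-vertex : ∀ {n} (G : Graph n) (B : Subset n) {k} → ∣ B ∣ ≡ 2 + k →
                      ∀ {v} → lookup B v ≡ true → Sigma2Le G B (+ ((2 + k) * deg G v) / ℕ.suc k)
σ₂≤-boundary-vertex {n} G B {k} ∣B∣≡2+k {v} v∈B =
  f , boundarySum≡0 , (v , v∈B , f[v]≢0) , ℚₚ.≤-reflexive energy≡
  where
  open ≡-Reasoning
  b : ℕ
  b = 2 + k
  c : ℚ
  c = + (b * deg G v) / ℕ.suc k
  f : Fin n → ℚ
  f = spike v b 1ℚ

  boundarySum≡0 : boundarySum B f ≡ 0ℚ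
  boundarySum≡0 = begin
    boundarySum B f          ≡⟨ boundarySum-spike B v∈B b ⟩
    fromℕ b ℚ.- fromℕ ∣ B ∣  ≡⟨ cong (λ m → fromℕ b ℚ.- fromℕ m) ∣B∣≡2+k ⟩
    fromℕ b ℚ.- fromℕ b      ≡⟨ ℚₚ.+-inverseʳ (fromℕ b) ⟩
    0ℚ                       ∎

  f[v]≡1+k : f v ≡ fromℕ (ℕ.suc k)
  f[v]≡1+k = begin
    fromℕ (b * 𝟙 v v) ℚ.- 1ℚ  ≡⟨ cong (λ m → fromℕ (b * m) ℚ.- 1ℚ) (𝟙-self v) ⟩
    fromℕ (b * 1) ℚ.- 1ℚ      ≡⟨ cong (λ m → fromℕ m ℚ.- 1ℚ) (ℕₚ.*-identityʳ b) ⟩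
    fromℕ b ℚ.- 1ℚ            ≡⟨ fromℕ-suc-1 (ℕ.suc k) ⟩
    fromℕ (ℕ.suc k)           ∎

  f[v]≢0 : f v ≢ 0ℚ
  f[v]≢0 f[v]≡0 = ℕₚ.1+n≢0 (fromℕ-injective (trans (sym f[v]≡1+k) (trans f[v]≡0 (sym fromℕ-0))))

  energy≡ : energy G f ≡ c ℚ.* boundaryNorm B f
  energy≡ = begin
    energy G f                            ≡⟨ energy-spike G v b 1ℚ ⟩
    fromℕ (b * b * d)                     ≡⟨ cong fromℕ (trans (ℕₚ.*-assoc b b d) (ℕₚ.*-comm b (b * d))) ⟩
    fromℕ (b * d * b)                     ≡⟨ fromℕ-homo-* (b * d) b ⟩
    fromℕ (b * d) ℚ.* fromℕ b             ≡⟨ cong (ℚ._* fromℕ b) (m/n*n≡m (b * d) k) ⟨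
    c ℚ.* fromℕ (ℕ.suc k) ℚ.* fromℕ b     ≡⟨ ℚₚ.*-assoc c (fromℕ (ℕ.suc k)) (fromℕ b) ⟩
    c ℚ.* (fromℕ (ℕ.suc k) ℚ.* fromℕ b)   ≡⟨ cong (c ℚ.*_) (fromℕ-homo-* (ℕ.suc k) b) ⟨
    c ℚ.* fromℕ (b + k * b)               ≡⟨ cong (λ m → c ℚ.* fromℕ (m + k * b)) ∣B∣≡2+k ⟨
    c ℚ.* fromℕ (∣ B ∣ + k * b)           ≡⟨ cong (c ℚ.*_) (boundaryNorm-spike B v∈B k) ⟨
    c ℚ.* boundaryNorm B f                ∎
    where d = deg G v

theorem1p4 : (n : ℕ) (G : Graph n) (B : Subset n) (hB : 2 ≤ ∣ B ∣) →
    Sigma2Le G B (steklovBound ∣ B ∣ (δB G B) hB)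
theorem1p4 n G B hB with ∣ B ∣ in ∣B∣≡ | hB
... | ℕ.suc (ℕ.suc k) | ℕ.s≤s (ℕ.s≤s _) =
  let v , v∈B , deg≡δB = δB-attained G B (subst (0 ℕ.<_) (sym ∣B∣≡) ℕ.z<s)
  in  subst (λ d → Sigma2Le G B (+ ((2 + k) * d) / ℕ.suc k)) deg≡δB (σ₂≤-boundary-vertex G B ∣B∣≡ v∈B)
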